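{- Let $\mathcal{T}=(V,E)$ be a trie on the alphabet $[1..\sigma]$, where each edge $e$ is labeled by a character $\ell(e)$ and the edges leaving any node have distinct labels. For a node $v$ reached from the root by the path $e_1,e_2,\dots,e_k$, define its label $\ell(v)=\ell(e_k)\,\ell(e_{k-1})\cdots\ell(e_1)$ (so the labels of the proper ancestors of $v$ other than the root are exactly the nonempty proper suffixes of $\ell(v)$). For a node $v$ and a character $a\in[1..\sigma]$ with $a|\ell(v) > 0$, let $a|v$ denote the node $w\in V$ whose label $\ell(w)$ is the suffix of $\ell(v)$ of length $a|\ell(v)$; otherwise $a|v$ is undefined. Then the set of return arcs $E'=\{(v,a|v) : v\in V,\ a\in[1..\sigma],\ a|v \text{ is defined}\}$ satisfies $|E'|\le 2|V|$.
   Context: A string $B\neq\varepsilon$ is a proper border of a string $W$ if $W=BX$ and $W=YB$ for nonempty strings $X,Y$. For a string $W$ and a character $a$, $a|W$ denotes the length of the longest proper border $B$ of $W$ that is preceded by the character $a$ when it occurs as a suffix of $W$, i.e. such that $W = Z a B$ for some string $Z$; $a|W = 0$ if no such border exists. -}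

module Defs where

open import Data.Nat using (ℕ; _<_; _≤_; _*_)
open import Data.Fin using (Fin)
open import Data.List using (List; []; _∷_; _++_; length)
open import Data.List.Relation.Unary.All using (All)
open import Data.List.Relation.Unary.Unique.Propositional using (Unique)
open import Data.Product using (Σ; ∃; ∃-syntax; _×_; _,_)
open import Data.Sum using (_⊎_)
open import Relation.Binary.PropositionalEquality using (_≡_; _≢_)
open import Relation.Nullary using (¬_)
open import Function.Definitions using (Injective)

Str : ℕ → Set
Str σ = List (Fin σ)

ProperBorder : ∀ {σ} → Str σ → Str σ → Set
ProperBorder {σ} B W =
  B ≢ [] × (∃[ X ] ∃[ Y ] (X ≢ [] × Y ≢ [] × W ≡ B ++ X × W ≡ Y ++ B))

PrecededBorder : ∀ {σ} → Fin σ → Str σ → Str σ → Set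
PrecededBorder {σ} a B W = ProperBorder B W × (∃[ Z ] (W ≡ Z ++ (a ∷ B)))

-- IsABar a W k : k = a|W (length of the longest proper border of W
-- preceded by a; 0 if no such border exists).
IsABar : ∀ {σ} → Fin σ → Str σ → ℕ → Set
IsABar {σ} a W k =
  (∃[ B ] (PrecededBorder a B W × length B ≡ k
           × (∀ B′ → PrecededBorder a B′ W → length B′ ≤ k)))
  ⊎ ((∀ B → ¬ PrecededBorder a B W) × k ≡ 0)

-- A trie with n nodes (nodes = Fin n) over alphabet [1..σ], given by its
-- node-labelling ℓ (ℓ(v) = reversed root-to-v path label).  A labelling
-- arises from a trie iff it is injective (distinct edge labels out of a
-- node), some node (the root) has label ε, and the labels are closed
-- under taking suffixes (the ancestors of v).
record IsTrie {σ n : ℕ} (ℓ : Fin n → Str σ) : Set where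
  field
    injective    : Injective _≡_ _≡_ ℓ
    root         : Fin n
    root-label   : ℓ root ≡ []
    suffix-closed : ∀ v (Z W : Str σ) → ℓ v ≡ Z ++ W → ∃[ u ] (ℓ u ≡ W)

ReturnArc : ∀ {σ n} → (Fin n → Str σ) → Fin n → Fin n → Set
ReturnArc {σ} ℓ v w =
  ∃[ a ] ∃[ k ] (IsABar a (ℓ v) k × 0 < k
                 × length (ℓ w) ≡ k × (∃[ Z ] (ℓ v ≡ Z ++ ℓ w)))

-- Charge each return arc (v, a|v) to a node.  If v has a child c labelled a·ℓ(v), charge it
-- to c; c determines a and v, hence the arc, as a|v is a longest border.  Otherwise write
-- ℓ(v) = B X with B = ℓ(a|v) the border, and charge the arc to the node labelled X (an
-- ancestor of v).  Both ℓ(v) and a·ℓ(v) have period |X| and end in X, so they are suffixes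
-- of ⋯XXX.  If two childless arcs shared X and |ℓ(v)| < |ℓ(v′)|, then a·ℓ(v) would be a
-- suffix of ℓ(v′), hence a node label; so ℓ(v) = ℓ(v′).  Thus the charging map into V ⊎ V
-- is injective.
module Submission where

open import Defs
open import Data.Nat using (ℕ; _≤_; _*_)
open import Data.Fin using (Fin)
open import Data.List using (List; length)
open import Data.List.Relation.Unary.All using (All)
open import Data.List.Relation.Unary.Unique.Propositional using (Unique)
open import Data.Product using (_×_; _,_)

open import Data.Empty using (⊥-elim)
open import Data.Fin using (zero; suc; join; splitAt)
open import Data.Fin.Properties using (any?; injective⇒≤; splitAt-join)
import Data.Fin.Properties as Fin
open import Data.List using ([]; _∷_; _++_; _∷ʳ_; lookup; take; drop)
open import Data.List.Properties
  using (∷-injectiveˡ; ∷-injectiveʳ; ∷ʳ-injectiveʳ; ∷ʳ-++; ++-cancelˡ; ++-cancelʳ;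
         ++-identityʳ; ++-identityʳ-unique; length-++; length-++-≤ʳ; length-drop;
         take++drop≡id; ≡-dec)
open import Data.List.Membership.Propositional.Properties using (∈-lookup)
import Data.List.Relation.Unary.All as All
open import Data.List.Relation.Unary.AllPairs using (_∷_)
open import Data.Nat using (suc; _+_; _∸_; _<_)
open import Data.Nat.Properties
  using (suc-injective; +-cancelʳ-≡; +-identityʳ; ≤-antisym; ≤-trans; ≤-reflexive; <-irrefl;
         ≮⇒≥; m∸[m∸n]≡n)
open import Data.Product using (∃-syntax; proj₁; proj₂)
open import Data.Sum using (_⊎_; inj₁; inj₂)
open import Data.Sum.Properties using (inj₂-injective)
open import Function.Definitions using (Injective)
open import Relation.Nullary using (¬_; Dec; yes; no)
open import Relation.Binary.PropositionalEquality

module _ {A : Set} where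

  lookup-injective : {xs : List A} → Unique xs → Injective _≡_ _≡_ (lookup xs)
  lookup-injective (_ ∷ _)       {zero}  {zero}  _  = refl
  lookup-injective (x∉xs ∷ _)    {zero}  {suc j} eq = ⊥-elim (All.lookup x∉xs (∈-lookup j) eq)
  lookup-injective (x∉xs ∷ _)    {suc i} {zero}  eq = ⊥-elim (All.lookup x∉xs (∈-lookup i) (sym eq))
  lookup-injective (_ ∷ unique)  {suc i} {suc j} eq = cong suc (lookup-injective unique eq)

  Unique-length-≤ : {P : A → Set} {m : ℕ} {xs : List A} → Unique xs → All P xs →
                    (f : ∀ {x} → P x → Fin m) →
                    (∀ {x y} (p : P x) (q : P y) → f p ≡ f q → x ≡ y) →
                    length xs ≤ m
  Unique-length-≤ unique ps f f-injective =
    injective⇒≤ {f = λ i → f (All.lookup ps (∈-lookup i))}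
      (λ eq → lookup-injective unique (f-injective _ _ eq))

  ++-injectiveˡ : ∀ (ws xs : List A) {ys zs} → length ws ≡ length xs → ws ++ ys ≡ xs ++ zs → ws ≡ xs
  ++-injectiveˡ []       []       _   _  = refl
  ++-injectiveˡ (_ ∷ ws) (_ ∷ xs) len eq =
    cong₂ _∷_ (∷-injectiveˡ eq) (++-injectiveˡ ws xs (suc-injective len) (∷-injectiveʳ eq))

  ++-injectiveʳ : ∀ (ws xs : List A) {ys zs} → length ys ≡ length zs → ws ++ ys ≡ xs ++ zs → ys ≡ zs
  ++-injectiveʳ ws xs {ys} {zs} len eq =
    ++-cancelˡ ws ys zs (trans eq (cong (_++ zs) (sym (++-injectiveˡ ws xs prefix-length eq))))
    where
    prefix-length : length ws ≡ length xs
    prefix-length = +-cancelʳ-≡ (length ys) (length ws) (length xs)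
      (trans (sym (length-++ ws)) (trans (cong length eq)
        (trans (length-++ xs) (cong (length xs +_) (sym len)))))

  -- W = B X = Y B: W ends in X and has period length X, i.e. W is a suffix of ⋯XXX.
  SuffixPeriod : List A → List A → Set
  SuffixPeriod X W = ∃[ B ] ∃[ Y ] (W ≡ B ++ X × W ≡ Y ++ B)

  suffixPeriod-∷ : ∀ {a X B Z W} → W ≡ B ++ X → W ≡ Z ++ a ∷ B → SuffixPeriod X (a ∷ W)
  suffixPeriod-∷ {a} {B = B} {Z} W≡BX W≡ZaB = a ∷ B , a ∷ Z , cong (a ∷_) W≡BX , cong (a ∷_) W≡ZaB

  suffixPeriod-length : ∀ {X W} → SuffixPeriod X W → length X ≤ length W
  suffixPeriod-length {X} (B , _ , refl , _) = length-++-≤ʳ X {B}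

  border-tail : ∀ {b y : A} {B X Y} → b ∷ B ++ X ≡ y ∷ Y ++ b ∷ B → B ++ X ≡ (Y ∷ʳ b) ++ B
  border-tail {b} {B = B} {Y = Y} eq = trans (∷-injectiveʳ eq) (sym (∷ʳ-++ Y b B))

  suffixPeriod-tail : ∀ {X d W} → SuffixPeriod X (d ∷ W) → length X ≤ length W → SuffixPeriod X W
  suffixPeriod-tail ([] , _ , refl , _) X≤W = ⊥-elim (<-irrefl refl X≤W)
  suffixPeriod-tail (b ∷ B , [] , eqB , refl) _
    with refl ← ++-identityʳ-unique (b ∷ B) eqB = B , [] , sym (++-identityʳ B) , refl
  suffixPeriod-tail (b ∷ B , y ∷ Y , eqB , eqY) _ =
    B , Y ∷ʳ b , ∷-injectiveʳ eqB , trans (∷-injectiveʳ eqB) (border-tail (trans (sym eqB) eqY))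

  suffixPeriod-drop : ∀ {X} Z {W} → SuffixPeriod X (Z ++ W) → length X ≤ length W → SuffixPeriod X W
  suffixPeriod-drop []      p _   = p
  suffixPeriod-drop (_ ∷ Z) {W} p X≤W =
    suffixPeriod-drop Z (suffixPeriod-tail p (≤-trans X≤W (length-++-≤ʳ W {Z}))) X≤W

  border-unique : ∀ {X} B B′ {Y Y′} → X ≢ [] → B ++ X ≡ Y ++ B → B′ ++ X ≡ Y′ ++ B′ →
                  length B ≡ length B′ → B ≡ B′
  border-unique []      []        _    _  _   _ = refl
  border-unique (b ∷ B) (_ ∷ _)   {[]} X≢[] eq _ _ = ⊥-elim (X≢[] (++-identityʳ-unique (b ∷ B) (sym eq)))
  border-unique (_ ∷ _) (b′ ∷ B′) {_ ∷ _} {[]} X≢[] _ eq′ _ =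
    ⊥-elim (X≢[] (++-identityʳ-unique (b′ ∷ B′) (sym eq′)))
  border-unique (b ∷ B) (b′ ∷ B′) {_ ∷ Y} {_ ∷ Y′} X≢[] eq eq′ len
    with refl ← border-unique B B′ X≢[] (border-tail eq) (border-tail eq′) (suc-injective len) =
    cong (_∷ B) (∷ʳ-injectiveʳ Y Y′ (++-cancelʳ B (Y ∷ʳ b) (Y′ ∷ʳ b′)
                                       (trans (sym (border-tail eq)) (border-tail eq′))))

  suffixPeriod-unique : ∀ {X V W} → X ≢ [] → SuffixPeriod X V → SuffixPeriod X W →
                        length V ≡ length W → V ≡ W
  suffixPeriod-unique {X} X≢[] (B , _ , refl , eq) (B′ , _ , refl , eq′) len
    with refl ← border-unique B B′ X≢[] eq eq′
                  (+-cancelʳ-≡ (length X) (length B) (length B′)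
                    (trans (sym (length-++ B)) (trans len (length-++ B′)))) = refl

  suffixPeriod-suffix : ∀ {X V W} → X ≢ [] → SuffixPeriod X V → SuffixPeriod X W →
                        length V ≤ length W → ∃[ Z ] (W ≡ Z ++ V)
  suffixPeriod-suffix {X} {V} {W} X≢[] pV pW V≤W = take t W , W≡take++V
    where
    t = length W ∸ length V
    drop-length : length (drop t W) ≡ length V
    drop-length = trans (length-drop t W) (m∸[m∸n]≡n V≤W)
    pdrop : SuffixPeriod X (drop t W)
    pdrop = suffixPeriod-drop (take t W) (subst (SuffixPeriod X) (sym (take++drop≡id t W)) pW)
              (≤-trans (suffixPeriod-length pV) (≤-reflexive (sym drop-length)))
    W≡take++V : W ≡ take t W ++ V
    W≡take++V = trans (sym (take++drop≡id t W))
                      (cong (take t W ++_) (suffixPeriod-unique X≢[] pdrop pV drop-length))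

record LongestPrecededBorder {σ : ℕ} (a : Fin σ) (B W : Str σ) : Set where
  field
    preceded : PrecededBorder a B W
    longest  : ∀ B′ → PrecededBorder a B′ W → length B′ ≤ length B

open LongestPrecededBorder

module _ {σ : ℕ} {a : Fin σ} where

  precededBorder⇒suffix : ∀ {B W : Str σ} → PrecededBorder a B W → ∃[ Y ] (W ≡ Y ++ B)
  precededBorder⇒suffix ((_ , _ , Y , _ , _ , _ , W≡YB) , _) = Y , W≡YB

  IsABar⇒longest : ∀ {W V Z : Str σ} {k} → IsABar a W k → 0 < k → length V ≡ k → W ≡ Z ++ V →
                   LongestPrecededBorder a V W
  IsABar⇒longest (inj₂ (_ , refl)) () _ _
  IsABar⇒longest {Z = Z} (inj₁ (B , p , refl , longest)) _ len W≡ZV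
    with Y , W≡YB ← precededBorder⇒suffix p
    with refl ← ++-injectiveʳ Z Y len (trans (sym W≡ZV) W≡YB) = record { preceded = p ; longest = longest }

  longestPrecededBorder-unique : ∀ {B B′ W : Str σ} →
    LongestPrecededBorder a B W → LongestPrecededBorder a B′ W → B ≡ B′
  longestPrecededBorder-unique {B} {B′} lb lb′
    with Y , W≡YB ← precededBorder⇒suffix (preceded lb)
       | Y′ , W≡Y′B′ ← precededBorder⇒suffix (preceded lb′) =
    ++-injectiveʳ Y Y′ (≤-antisym (longest lb′ B (preceded lb)) (longest lb B′ (preceded lb′)))
      (trans (sym W≡YB) W≡Y′B′)

module Charging {σ n : ℕ} {ℓ : Fin n → Str σ} (trie : IsTrie ℓ) where
  open IsTrie trie

  Child : Fin σ → Fin n → Set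
  Child a v = ∃[ c ] (ℓ c ≡ a ∷ ℓ v)

  child? : ∀ a v → Dec (Child a v)
  child? a v = any? (λ c → ≡-dec Fin._≟_ (ℓ c) (a ∷ ℓ v))

  returnArc⇒longest : ∀ {v w} → ReturnArc ℓ v w → ∃[ a ] LongestPrecededBorder a (ℓ w) (ℓ v)
  returnArc⇒longest (a , _ , a|v , 0<k , len , Z , v≡Zw) = a , IsABar⇒longest a|v 0<k len v≡Zw

  childless-same-length : ∀ {X a v a′ v′} → X ≢ [] →
    SuffixPeriod X (ℓ v) → SuffixPeriod X (a ∷ ℓ v) → ¬ Child a v →
    SuffixPeriod X (ℓ v′) → SuffixPeriod X (a′ ∷ ℓ v′) → ¬ Child a′ v′ →
    length (ℓ v) ≡ length (ℓ v′)
  childless-same-length {X} X≢[] pv pav ¬child pv′ pav′ ¬child′ =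
    ≤-antisym (≮⇒≥ (not-shorter pav′ ¬child′ pv)) (≮⇒≥ (not-shorter pav ¬child pv′))
    where
    not-shorter : ∀ {a v v′} → SuffixPeriod X (a ∷ ℓ v) → ¬ Child a v →
                  SuffixPeriod X (ℓ v′) → ¬ length (ℓ v) < length (ℓ v′)
    not-shorter {v′ = v′} pav ¬child pv′ v<v′ =
      ¬child (suffix-closed v′ _ _ (proj₂ (suffixPeriod-suffix X≢[] pav pv′ v<v′)))

  childless-arc-unique : ∀ {X a v w a′ v′ w′} → X ≢ [] →
    ℓ v ≡ ℓ w ++ X → SuffixPeriod X (ℓ v) → SuffixPeriod X (a ∷ ℓ v) → ¬ Child a v →
    ℓ v′ ≡ ℓ w′ ++ X → SuffixPeriod X (ℓ v′) → SuffixPeriod X (a′ ∷ ℓ v′) → ¬ Child a′ v′ →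
    v ≡ v′ × w ≡ w′
  childless-arc-unique {X} {w = w} {w′ = w′} X≢[] v≡wX pv pav ¬child v′≡w′X pv′ pav′ ¬child′
    with refl ← injective (suffixPeriod-unique X≢[] pv pv′
                  (childless-same-length X≢[] pv pav ¬child pv′ pav′ ¬child′)) =
    refl , injective (++-cancelʳ X (ℓ w) (ℓ w′) (trans (sym v≡wX) v′≡w′X))

  chargeWith : ∀ {a v w} → PrecededBorder a (ℓ w) (ℓ v) → Dec (Child a v) → Fin n ⊎ Fin n
  chargeWith _ (yes (c , _)) = inj₁ c
  chargeWith {v = v} ((_ , X , _ , _ , _ , v≡wX , _) , _) (no _) =
    inj₂ (proj₁ (suffix-closed v _ X v≡wX))

  chargeWith-injective : ∀ {a v w a′ v′ w′}
    (lb : LongestPrecededBorder a (ℓ w) (ℓ v)) (lb′ : LongestPrecededBorder a′ (ℓ w′) (ℓ v′))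
    (c? : Dec (Child a v)) (c′? : Dec (Child a′ v′)) →
    chargeWith (preceded lb) c? ≡ chargeWith (preceded lb′) c′? → v ≡ v′ × w ≡ w′
  chargeWith-injective lb lb′ (yes (_ , c≡av)) (yes (_ , c≡a′v′)) refl
    with refl ← ∷-injectiveˡ (trans (sym c≡av) c≡a′v′)
       | refl ← injective (∷-injectiveʳ (trans (sym c≡av) c≡a′v′)) =
    refl , injective (longestPrecededBorder-unique lb lb′)
  chargeWith-injective _ _ (yes _) (no _) ()
  chargeWith-injective _ _ (no _) (yes _) ()
  chargeWith-injective {v = v} {v′ = v′} lb lb′ (no ¬child) (no ¬child′) eq
    with ((_ , X , Y , X≢[] , _ , v≡wX , v≡Yw) , Z , v≡Zaw) ← preceded lb
       | ((_ , X′ , Y′ , _ , _ , v′≡w′X′ , v′≡Y′w′) , Z′ , v′≡Z′a′w′) ← preceded lb′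
    with refl ← trans (sym (proj₂ (suffix-closed v _ X v≡wX)))
                  (trans (cong ℓ (inj₂-injective eq)) (proj₂ (suffix-closed v′ _ X′ v′≡w′X′))) =
    childless-arc-unique X≢[]
      v≡wX (_ , Y , v≡wX , v≡Yw) (suffixPeriod-∷ v≡wX v≡Zaw) ¬child
      v′≡w′X′ (_ , Y′ , v′≡w′X′ , v′≡Y′w′) (suffixPeriod-∷ v′≡w′X′ v′≡Z′a′w′) ¬child′

  charge : ∀ {v w} → ReturnArc ℓ v w → Fin n ⊎ Fin n
  charge {v} r = let a , lb = returnArc⇒longest r in chargeWith (preceded lb) (child? a v)

  charge-injective : ∀ {v w v′ w′} (r : ReturnArc ℓ v w) (r′ : ReturnArc ℓ v′ w′) →
                     charge r ≡ charge r′ → (v , w) ≡ (v′ , w′)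
  charge-injective r r′ eq
    with refl , refl ← chargeWith-injective (proj₂ (returnArc⇒longest r))
                                            (proj₂ (returnArc⇒longest r′)) _ _ eq = refl

lemma3 : (σ n : ℕ) (ℓ : Fin n → Str σ) → IsTrie ℓ →
         (E′ : List (Fin n × Fin n)) → Unique E′ →
         All (λ { (v , w) → ReturnArc ℓ v w }) E′ →
         length E′ ≤ 2 * n
lemma3 σ n ℓ trie E′ unique arcs =
  subst (length E′ ≤_) (cong (n +_) (sym (+-identityʳ n)))
    (Unique-length-≤ unique arcs (λ r → join n n (charge r))
      (λ r r′ eq → charge-injective r r′ (join-injective eq)))
  where
  open Charging trie
  join-injective : ∀ {i j} → join n n i ≡ join n n j → i ≡ j
  join-injective {i} {j} eq =
    trans (sym (splitAt-join n n i)) (trans (cong (splitAt n) eq) (splitAt-join n n j))
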